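{- Let $(X,\tau)$ be a $T_d$-space with derivative $d=d_\tau$, and let $d^+$ be the derivative operator of $(X,\tau^+)$. Then for all $x\in X$ and $A\subseteq X$, $x\in d^+A$ if and only if both (i) $x$ is doubly $d$-reflexive, and (ii) for all $B\subseteq X$, $x\in dB$ implies $x\in d(A\cap dB)$.
   Context: For $A\subseteq X$, $d(A)$ is the set of limit points of $A$ in $(X,\tau)$. $(X,\tau)$ is $T_d$ if $d(A)$ is closed for every $A\subseteq X$. $\tau^+$ is the coarsest topology on $X$ containing $\tau$ in which every set $d(A)$, $A\subseteq X$, is open. A point $x$ is doubly $d$-reflexive if $x\in d(X)$ and for all $A_1,A_2\subseteq X$, $x\in dA_1\cap dA_2$ implies $x\in d(dA_1\cap dA_2)$. -}

module Defs where

open import Level using (Level; 0ℓ; _⊔_) renaming (suc to lsuc)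
open import Data.Product using (Σ; ∃; ∃-syntax; _×_; _,_)
open import Data.Sum using (_⊎_)
open import Data.List using (List; []; _∷_)
open import Data.Unit using (⊤)
open import Data.List.Relation.Unary.All using (All)
open import Relation.Unary using (Pred; _∈_; _∩_; _⊆_; ∁; _≐_; U)
open import Relation.Binary.PropositionalEquality using (_≢_)

Subset : Set → Set₁
Subset X = Pred X 0ℓ

-- A topology on X, presented (predicatively) as a family of open sets
-- indexed by a small type Idx, closed (up to extensional equality of
-- subsets) under finite intersections and arbitrary unions.
record Topology (X : Set) : Set₁ where
  field
    Idx   : Set
    O     : Idx → Subset X
    top-univ : ∃[ i ] (O i ≐ U)
    top-∩    : ∀ i j → ∃[ k ] (O k ≐ (O i ∩ O j))
    top-⋃    : ∀ {J : Set} (f : J → Idx) → ∃[ k ] (O k ≐ (λ x → ∃[ j ] (x ∈ O (f j))))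
open Topology public

IsOpen : ∀ {X : Set} → Topology X → Subset X → Set
IsOpen τ V = ∃[ i ] (O τ i ≐ V)

d : ∀ {X : Set} → Topology X → Subset X → Subset X
d {X} τ A x = ∀ (i : Idx τ) → x ∈ O τ i → ∃[ y ] (y ∈ O τ i × y ∈ A × y ≢ x)

IsClosed : ∀ {X : Set} → Topology X → Subset X → Set
IsClosed τ C = IsOpen τ (∁ C)

Td : ∀ {X : Set} → Topology X → Set₁
Td {X} τ = ∀ (A : Subset X) → IsClosed τ (d τ A)

⋂L : ∀ {X : Set} → List (Subset X) → Subset X
⋂L []       x = ⊤
⋂L (V ∷ Ls) x = x ∈ V × ⋂L Ls x

-- Open sets of the topology generated by a subbasis S (the coarsest
-- topology containing S): V is open iff every point of V lies in some
-- finite intersection of members of S that is contained in V.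
GenOpen : ∀ {X : Set} {ℓ : Level} → (Subset X → Set ℓ) → Subset X → Set (lsuc 0ℓ ⊔ ℓ)
GenOpen {X} S V = ∀ x → x ∈ V → ∃[ Ls ] (All S Ls × x ∈ ⋂L Ls × ⋂L Ls ⊆ V)

SubPlus : ∀ {X : Set} → Topology X → Subset X → Set₁
SubPlus {X} τ V = IsOpen τ V ⊎ ∃[ A ] (V ≐ d τ A)

IsOpen⁺ : ∀ {X : Set} → Topology X → Subset X → Set₁
IsOpen⁺ τ = GenOpen (SubPlus τ)

d⁺ : ∀ {X : Set} → Topology X → Subset X → Pred X (lsuc 0ℓ)
d⁺ {X} τ A x = ∀ (V : Subset X) → IsOpen⁺ τ V → x ∈ V → ∃[ y ] (y ∈ V × y ∈ A × y ≢ x)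

DoublyReflexive : ∀ {X : Set} → Topology X → X → Set₁
DoublyReflexive {X} τ x =
  x ∈ d τ U ×
  (∀ (A₁ A₂ : Subset X) → x ∈ d τ A₁ → x ∈ d τ A₂ → x ∈ d τ (d τ A₁ ∩ d τ A₂))

-- Forward direction (no T_d needed).  Finite intersections of subbasic
-- sets are τ⁺-open (⋂L-open⁺).  Hence a τ⁺-limit point x of A is a
-- τ-limit point of A (d⁺⊆d), and, since O ∩ d C₁ ∩ d C₂ is τ⁺-open, x is
-- a τ-limit point of A ∩ d C₁ ∩ d C₂ whenever x ∈ d C₁ ∩ d C₂
-- (d⁺-trap).  Both (i) and (ii) follow from this by monotonicity of d.
--
-- Backward direction.  In a T_d space d(d C) ⊆ d C (dd⊆d, using excluded
-- middle).  Call a τ⁺-neighbourhood W of x "trapped" if it contains a set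
-- O ∩ d B with O τ-open, x ∈ O and x ∈ d B.  If x is doubly reflexive,
-- every finite intersection of subbasic sets around x is trapped
-- (reflexive-traps): d X traps the whole space, τ-open sets are absorbed
-- into O, and a new factor d C is absorbed into d(d B ∩ d C) ⊆ d B ∩ d C.
-- Condition (ii) then yields a point of A ≠ x inside every trap.
module Submission where

open import Defs
open import Level using (0ℓ; suc; Lift; lift)
open import Axiom.ExcludedMiddle using (ExcludedMiddle)
open import Data.Product using (_×_; _,_; proj₁; proj₂; ∃-syntax)
open import Data.Sum using (inj₁; inj₂)
open import Data.Unit using (tt)
open import Data.List using (List; []; _∷_)
open import Data.List.Relation.Unary.All using (All; []; _∷_)
open import Data.Empty using (⊥-elim)
open import Relation.Nullary using (yes; no)
open import Function.Bundles using (_⇔_; mk⇔)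
open import Relation.Unary using (_∈_; _∩_; _⊆_; U)

module _ {X : Set} (τ : Topology X) where

  d-mono : ∀ {A B : Subset X} → A ⊆ B → d τ A ⊆ d τ B
  d-mono A⊆B x∈dA i x∈Oi with x∈dA i x∈Oi
  ... | y , y∈Oi , y∈A , y≢x = y , y∈Oi , A⊆B y∈A , y≢x

  ⋂L-open⁺ : ∀ (Ls : List (Subset X)) → All (SubPlus τ) Ls → IsOpen⁺ τ (⋂L Ls)
  ⋂L-open⁺ Ls subbasic x x∈⋂ = Ls , subbasic , x∈⋂ , λ y∈⋂ → y∈⋂

  open-subbasic : ∀ i → SubPlus τ (O τ i)
  open-subbasic i = inj₁ (i , (λ p → p) , (λ p → p))

  d-subbasic : ∀ C → SubPlus τ (d τ C)
  d-subbasic C = inj₂ (C , (λ p → p) , (λ p → p))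

  -- τ ⊆ τ⁺, so every τ⁺-limit point is a τ-limit point.
  d⁺⊆d : ∀ {A : Subset X} {x} → x ∈ d⁺ τ A → x ∈ d τ A
  d⁺⊆d {x = x} x∈d⁺A i x∈Oi
    with x∈d⁺A (⋂L (O τ i ∷ [])) (⋂L-open⁺ _ (open-subbasic i ∷ [])) (x∈Oi , tt)
  ... | y , (y∈Oi , tt) , y∈A , y≢x = y , y∈Oi , y∈A , y≢x

  -- A τ⁺-limit point of A lying in d C₁ ∩ d C₂ is a τ-limit point of
  -- A ∩ d C₁ ∩ d C₂, since O ∩ d C₁ ∩ d C₂ is a τ⁺-neighbourhood of it.
  d⁺-trap : ∀ {A : Subset X} {x} (C₁ C₂ : Subset X) →
            x ∈ d⁺ τ A → x ∈ d τ C₁ → x ∈ d τ C₂ →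
            x ∈ d τ (λ y → y ∈ A × y ∈ d τ C₁ × y ∈ d τ C₂)
  d⁺-trap C₁ C₂ x∈d⁺A x∈dC₁ x∈dC₂ i x∈Oi
    with x∈d⁺A (⋂L (O τ i ∷ d τ C₁ ∷ d τ C₂ ∷ []))
               (⋂L-open⁺ _ (open-subbasic i ∷ d-subbasic C₁ ∷ d-subbasic C₂ ∷ []))
               (x∈Oi , x∈dC₁ , x∈dC₂ , tt)
  ... | y , (y∈Oi , y∈dC₁ , y∈dC₂ , tt) , y∈A , y≢x =
    y , y∈Oi , (y∈A , y∈dC₁ , y∈dC₂) , y≢x

  Trapped : X → Subset X → Set₁
  Trapped x W = ∃[ i ] ∃[ B ] (x ∈ O τ i × x ∈ d τ B × O τ i ∩ d τ B ⊆ W)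

  trapped-mono : ∀ {x} {W W′ : Subset X} → W ⊆ W′ → Trapped x W → Trapped x W′
  trapped-mono W⊆W′ (i , B , x∈Oi , x∈dB , trap) =
    i , B , x∈Oi , x∈dB , λ y∈ → W⊆W′ (trap y∈)

  trapped-univ : ∀ {x} → x ∈ d τ U → Trapped x U
  trapped-univ x∈dU with top-univ τ
  ... | i , _ , U⊆Oi = i , U , U⊆Oi tt , x∈dU , λ _ → tt

  trapped-∩-open : ∀ {x} {W : Subset X} j → x ∈ O τ j →
                   Trapped x W → Trapped x (O τ j ∩ W)
  trapped-∩-open j x∈Oj (i , B , x∈Oi , x∈dB , trap) with top-∩ τ i j
  ... | k , Ok⊆ , ⊆Ok =
    k , B , ⊆Ok (x∈Oi , x∈Oj) , x∈dB ,
    λ (y∈Ok , y∈dB) → let (y∈Oi , y∈Oj) = Ok⊆ y∈Ok in y∈Oj , trap (y∈Oi , y∈dB)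

module _ (em : ExcludedMiddle (suc 0ℓ)) {X : Set} (τ : Topology X) (td : Td τ) where

  -- In a T_d space d(d C) ⊆ d C: the complement of the closed set d C is a
  -- neighbourhood of any point outside d C that misses d C.
  dd⊆d : ∀ (C : Subset X) → d τ (d τ C) ⊆ d τ C
  dd⊆d C {y} y∈ddC with em {Lift (suc 0ℓ) (y ∈ d τ C)}
  ... | yes (lift y∈dC) = y∈dC
  ... | no y∉dC with td C
  ...   | j , Oj⊆∁ , ∁⊆Oj with y∈ddC j (∁⊆Oj (λ y∈dC → y∉dC (lift y∈dC)))
  ...     | z , z∈Oj , z∈dC , _ = ⊥-elim (Oj⊆∁ z∈Oj z∈dC)

  -- At a doubly reflexive point, a factor d C with x ∈ d C is absorbed into
  -- the derived part of the trap: O ∩ d(d B ∩ d C) ⊆ O ∩ d B ∩ d C.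
  trapped-∩-d : ∀ {x} {W : Subset X} C → DoublyReflexive τ x → x ∈ d τ C →
                Trapped τ x W → Trapped τ x (d τ C ∩ W)
  trapped-∩-d C (_ , double) x∈dC (i , B , x∈Oi , x∈dB , trap) =
    i , (d τ B ∩ d τ C) , x∈Oi , double B C x∈dB x∈dC ,
    λ (y∈Oi , y∈d[dB∩dC]) →
      dd⊆d C (d-mono τ proj₂ y∈d[dB∩dC]) ,
      trap (y∈Oi , dd⊆d B (d-mono τ proj₁ y∈d[dB∩dC]))

  reflexive-traps : ∀ {x} (Ls : List (Subset X)) → DoublyReflexive τ x →
                    All (SubPlus τ) Ls → x ∈ ⋂L Ls → Trapped τ x (⋂L Ls)
  reflexive-traps [] (x∈dU , _) [] tt = trapped-univ τ x∈dU
  reflexive-traps (V ∷ Ls) reflexive (inj₁ (j , Oj⊆V , V⊆Oj) ∷ subbasic) (x∈V , x∈⋂) =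
    trapped-mono τ (λ (y∈Oj , y∈⋂) → Oj⊆V y∈Oj , y∈⋂)
      (trapped-∩-open τ j (V⊆Oj x∈V) (reflexive-traps Ls reflexive subbasic x∈⋂))
  reflexive-traps (V ∷ Ls) reflexive (inj₂ (C , V⊆dC , dC⊆V) ∷ subbasic) (x∈V , x∈⋂) =
    trapped-mono τ (λ (y∈dC , y∈⋂) → dC⊆V y∈dC , y∈⋂)
      (trapped-∩-d C reflexive (V⊆dC x∈V) (reflexive-traps Ls reflexive subbasic x∈⋂))

mainTheorem6 : ExcludedMiddle (suc 0ℓ) → (X : Set) (τ : Topology X) → Td τ →
    ∀ (x : X) (A : Subset X) →
    (x ∈ d⁺ τ A) ⇔
    (DoublyReflexive τ x × (∀ (B : Subset X) → x ∈ d τ B → x ∈ d τ (A ∩ d τ B)))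
mainTheorem6 em X τ td x A = mk⇔ to from
  where
  to : x ∈ d⁺ τ A → DoublyReflexive τ x × (∀ B → x ∈ d τ B → x ∈ d τ (A ∩ d τ B))
  to x∈d⁺A =
    ( d-mono τ (λ _ → tt) (d⁺⊆d τ x∈d⁺A)
    , λ A₁ A₂ x∈dA₁ x∈dA₂ →
        d-mono τ proj₂ (d⁺-trap τ A₁ A₂ x∈d⁺A x∈dA₁ x∈dA₂) )
    , λ B x∈dB →
        d-mono τ (λ (y∈A , y∈dB , _) → y∈A , y∈dB) (d⁺-trap τ B B x∈d⁺A x∈dB x∈dB)

  from : DoublyReflexive τ x × (∀ B → x ∈ d τ B → x ∈ d τ (A ∩ d τ B)) → x ∈ d⁺ τ A
  from (reflexive , limit) V V-open x∈V with V-open x x∈V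
  ... | Ls , subbasic , x∈⋂ , ⋂⊆V with reflexive-traps em τ td Ls reflexive subbasic x∈⋂
  ...   | i , B , x∈Oi , x∈dB , trap with limit B x∈dB i x∈Oi
  ...     | y , y∈Oi , (y∈A , y∈dB) , y≢x = y , ⋂⊆V (trap (y∈Oi , y∈dB)) , y∈A , y≢x
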